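{- Let $G=(\Gamma,s)$ be a graph with non-sink vertex set $\tilde V$. If $s$ is not a cut vertex of $G$, then the constant function $\mathbf 1:\tilde V\to\mathbb N$, $v\mapsto1$, is a prime $G$-parking function. Otherwise, $\mathrm{PPF}(G)=\emptyset$.
   Context: A graph $G=(\Gamma,s)$ is a finite, undirected, connected multigraph (multiple edges allowed, no loops) with vertex set $V$ and distinguished sink $s$; $\tilde V=V\setminus\{s\}$. $s$ is a cut vertex if removing it disconnects $G$. $\mathrm{mult}(vw)$ is the number of edges between $v,w$; $\deg^A(v)=\sum_{w\in A}\mathrm{mult}(vw)$. $\mathbb N=\{1,2,\dots\}$. For a graph $H$ with sink $s$, vertex set $V_H$, non-sink vertex set $\tilde V_H$ (not necessarily connected), an $H$-parking function is $p:\tilde V_H\to\mathbb N$ such that every non-empty $S\subseteq\tilde V_H$ contains $v$ with $p(v)\le\deg^{V_H\setminus S}(v)$; $\mathrm{PF}(H)$ is their set. For $A\subseteq\tilde V$, $G^A$ is the induced subgraph of $G$ on $A\cup\{s\}$ with sink $s$. For $p\in\mathrm{PF}(G)$ and an ordered partition $(A,B)$ of $\tilde V$ with $A,B\neq\emptyset$, set $p^A=p|_A$ and $p^B(v)=p(v)-\deg^A(v)$ for $v\in B$; $p$ is decomposable w.r.t. $(A,B)$ if $p^A\in\mathrm{PF}(G^A)$ and $p^B\in\mathrm{PF}(G^B)$; $p$ is prime if it is decomposable w.r.t. no such partition; $\mathrm{PPF}(G)$ is the set of prime $G$-parking functions. -}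

module Defs where

open import Data.Nat using (ℕ; zero; suc; _+_; _∸_; _≤_; _<_)
open import Data.Fin using (Fin; zero; suc)
open import Data.Fin.Subset using (Subset; _∈_; _⊆_; ∁; _─_; ⊤; Nonempty)
open import Data.Fin.Subset.Properties using (_∈?_)
open import Data.Product using (Σ; ∃; _×_)
open import Relation.Binary.PropositionalEquality using (_≡_)
open import Relation.Nullary using (¬_; yes; no)

-- Convention: a graph with n non-sink vertices has vertex set Fin (suc n);
-- the sink s is the vertex `zero`, and the non-sink vertex i : Fin n is `suc i`.

∑ : ∀ {k} → (Fin k → ℕ) → ℕ
∑ {zero}  f = 0
∑ {suc k} f = f zero + ∑ (λ i → f (suc i))

data Path {k : ℕ} (E : Fin k → Fin k → ℕ) : Fin k → Fin k → Set where
  here : ∀ {u} → Path E u u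
  step : ∀ {u w v} → 0 < E u w → Path E w v → Path E u v

record Graph (n : ℕ) : Set where
  field
    mult      : Fin (suc n) → Fin (suc n) → ℕ
    symmetric : ∀ u v → mult u v ≡ mult v u
    noLoops   : ∀ v → mult v v ≡ 0
    connected : ∀ u v → Path mult u v

module _ {n : ℕ} (G : Graph n) where
  open Graph G

  multMinusSink : Fin n → Fin n → ℕ
  multMinusSink i j = mult (suc i) (suc j)

  IsCutVertex : Set
  IsCutVertex = ¬ (∀ u v → Path multMinusSink u v)

  deg : Subset n → Fin n → ℕ
  deg A v = ∑ λ w → degTerm w
    where
    degTerm : Fin n → ℕ
    degTerm w with w ∈? A
    ... | yes _ = mult (suc v) (suc w)
    ... | no  _ = 0

  degSink : Fin n → ℕ
  degSink v = mult (suc v) zero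

  -- p is a G^A-parking function (only the values of p on A matter).
  -- Values are taken in ℕ with the explicit requirement p v ≥ 1 on A,
  -- so that p restricted to A is a function A → {1,2,...}.
  -- In G^A (induced on A ∪ {s}), deg^{V_H ∖ S}(v) = degSink v + deg (A ─ S) v.
  IsPFOn : Subset n → (Fin n → ℕ) → Set
  IsPFOn A p =
    (∀ v → v ∈ A → 1 ≤ p v) ×
    (∀ S → S ⊆ A → Nonempty S →
       ∃ λ v → v ∈ S × p v ≤ degSink v + deg (A ─ S) v)

  IsPF : (Fin n → ℕ) → Set
  IsPF p = IsPFOn ⊤ p

  -- Decomposability w.r.t. the ordered partition (A, ∁ A).
  -- p^B(v) = p(v) − deg^A(v); truncated subtraction is harmless because
  -- IsPFOn demands p^B(v) ≥ 1, which holds iff the integer p(v) − deg^A(v) ≥ 1.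
  Decomposable : (Fin n → ℕ) → Subset n → Set
  Decomposable p A =
    IsPFOn A p × IsPFOn (∁ A) (λ v → p v ∸ deg A v)

  IsPrimePF : (Fin n → ℕ) → Set
  IsPrimePF p =
    IsPF p ×
    (∀ A → Nonempty A → Nonempty (∁ A) → ¬ Decomposable p A)

one : ∀ {n} → Fin n → ℕ
one _ = 1

-- A set A of non-sink vertices with no edge between A and its complement
-- ("separated") splits every parking function: on either side the sink
-- condition only sees edges inside that side, and the correction deg^A vanishes
-- on the complement.  If s is a cut vertex, the component of G − s containing
-- any vertex is such a nontrivial set, so nothing is prime.  Conversely, the
-- constant function 1 parks because every nonempty S is entered by a walk from
-- the sink; and it can only decompose along (A, B) if 1 − deg^A(v) ≥ 1 on B,
-- i.e. if B is separated from A, which is impossible when G − s is connected.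
module Submission where

open import Defs
open import Data.Nat using (ℕ)
open import Data.Fin using (Fin)
open import Data.Product using (_×_)
open import Relation.Nullary using (¬_)

open import Data.Nat using (zero; suc; _+_; _∸_; _≤_; _<_; _≟_)
open import Data.Nat.Properties using (≤-refl; ≤-trans; m≤m+n; m≤n+m; n≤0⇒n≡0; n≢0⇒n>0; <⇒≢)
open import Data.Fin using (zero; suc)
open import Data.Fin.Subset using (Subset; _∈_; _∉_; ∁; _─_; ⊤; inside; outside)
open import Data.Fin.Subset.Properties
  using (_∈?_; ∈⊤; x∈p∧x∉q⇒x∈p─q; x∈p⇒x∉∁p; x∈∁p⇒x∉p; x∉p⇒x∈∁p; x∉∁p⇒x∈p)
open import Data.Product using (Σ-syntax; ∃; ∃₂; _,_; proj₁)
open import Data.Vec using (tabulate; _∷_; here; there)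
open import Data.Vec.Properties using (lookup∘tabulate; lookup⇒[]=; []=⇒lookup)
open import Relation.Nullary using (Dec; yes; no; does; contradiction)
open import Relation.Nullary.Decidable using (dec-true; ¬¬-excluded-middle)
open import Level using (0ℓ)
open import Relation.Unary using (Pred; Decidable)
open import Relation.Binary.PropositionalEquality using (_≡_; refl; sym; trans; cong; cong₂; subst)

∑-cong : ∀ {k} {f g : Fin k → ℕ} → (∀ i → f i ≡ g i) → ∑ f ≡ ∑ g
∑-cong {zero}  f≗g = refl
∑-cong {suc k} f≗g = cong₂ _+_ (f≗g zero) (∑-cong (λ i → f≗g (suc i)))

∑-≡0 : ∀ {k} {f : Fin k → ℕ} → (∀ i → f i ≡ 0) → ∑ f ≡ 0
∑-≡0 {zero}  f≗0 = refl
∑-≡0 {suc k} f≗0 rewrite f≗0 zero = ∑-≡0 (λ i → f≗0 (suc i))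

f≤∑f : ∀ {k} (f : Fin k → ℕ) i → f i ≤ ∑ f
f≤∑f f zero    = m≤m+n _ _
f≤∑f f (suc i) = ≤-trans (f≤∑f (λ j → f (suc j)) i) (m≤n+m _ _)

1≤1∸n⇒n≡0 : ∀ {n} → 1 ≤ 1 ∸ n → n ≡ 0
1≤1∸n⇒n≡0 {zero}        _  = refl
1≤1∸n⇒n≡0 {suc zero}    ()
1≤1∸n⇒n≡0 {suc (suc n)} ()

x∈p─q⇒x∉q : ∀ {k} {x : Fin k} (p q : Subset k) → x ∈ p ─ q → x ∉ q
x∈p─q⇒x∉q (_ ∷ p) (outside ∷ q) (there x∈p─q) (there x∈q) = x∈p─q⇒x∉q p q x∈p─q x∈q
x∈p─q⇒x∉q (_ ∷ p) (inside  ∷ q) (there x∈p─q) (there x∈q) = x∈p─q⇒x∉q p q x∈p─q x∈q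

module _ {k} {P : Pred (Fin k) 0ℓ} (P? : Decidable P) where

  subsetOf : Subset k
  subsetOf = tabulate (λ x → does (P? x))

  ∈-subsetOf⁺ : ∀ {x} → P x → x ∈ subsetOf
  ∈-subsetOf⁺ {x} px = lookup⇒[]= x _ (trans (lookup∘tabulate _ x) (dec-true (P? x) px))

  ∈-subsetOf⁻ : ∀ {x} → x ∈ subsetOf → P x
  ∈-subsetOf⁻ {x} x∈ with P? x | trans (sym (lookup∘tabulate (λ y → does (P? y)) x)) ([]=⇒lookup x∈)
  ... | yes px  | _  = px
  ... | no  ¬px | ()

¬¬-∀-Fin : ∀ {k} {P : Fin k → Set} → (∀ i → ¬ ¬ P i) → ¬ ¬ (∀ i → P i)
¬¬-∀-Fin {zero}      ¬¬P ¬∀P = ¬∀P (λ ())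
¬¬-∀-Fin {suc k} {P} ¬¬P ¬∀P = ¬¬P zero λ P0 →
  ¬¬-∀-Fin (λ i → ¬¬P (suc i)) λ P∘suc → ¬∀P λ { zero → P0 ; (suc i) → P∘suc i }

module _ {k} {E : Fin k → Fin k → ℕ} where

  Path-snoc : ∀ {a b c} → Path E a b → 0 < E b c → Path E a c
  Path-snoc here       e′ = step e′ here
  Path-snoc (step e p) e′ = step e (Path-snoc p e′)

  boundaryEdge : {P : Pred (Fin k) 0ℓ} → Decidable P → ∀ {a b} → Path E a b → ¬ P a → P b →
                 ∃₂ λ x y → ¬ P x × P y × 0 < E x y
  boundaryEdge P? here        ¬Pa Pb = contradiction Pb ¬Pa
  boundaryEdge P? {a} (step {w = w} e p) ¬Pa Pb with P? w
  ... | yes Pw = a , w , ¬Pa , Pw , e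
  ... | no ¬Pw = boundaryEdge P? p ¬Pw Pb

module _ {n} (G : Graph n) where
  open Graph G

  -- The summand of deg is hidden in a where-block of Defs; unification
  -- recovers it, and it still computes on (w ∈? A).
  private
    deg-as-∑ : ∀ A v → Σ[ f ∈ (Fin n → ℕ) ] deg G A v ≡ ∑ f
    deg-as-∑ A v = _ , refl

  degTerm : Subset n → Fin n → Fin n → ℕ
  degTerm A v = proj₁ (deg-as-∑ A v)

  degTerm-∈ : ∀ {A} v {w} → w ∈ A → degTerm A v w ≡ mult (suc v) (suc w)
  degTerm-∈ {A} v {w} w∈A with w ∈? A
  ... | yes _   = refl
  ... | no  w∉A = contradiction w∈A w∉A

  degTerm-∉ : ∀ {A} v {w} → w ∉ A → degTerm A v w ≡ 0
  degTerm-∉ {A} v {w} w∉A with w ∈? A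
  ... | yes w∈A = contradiction w∈A w∉A
  ... | no  _   = refl

  mult≤deg : ∀ {A} v {w} → w ∈ A → mult (suc v) (suc w) ≤ deg G A v
  mult≤deg {A} v {w} w∈A = subst (_≤ deg G A v) (degTerm-∈ v w∈A) (f≤∑f (degTerm A v) w)

  deg-cong : ∀ {A B} v →
             (∀ {w} → w ∈ A → w ∉ B → mult (suc v) (suc w) ≡ 0) →
             (∀ {w} → w ∈ B → w ∉ A → mult (suc v) (suc w) ≡ 0) →
             deg G A v ≡ deg G B v
  deg-cong {A} {B} v A∖B B∖A = ∑-cong λ w → pointwise (w ∈? A) (w ∈? B)
    where
    pointwise : ∀ {w} → Dec (w ∈ A) → Dec (w ∈ B) → degTerm A v w ≡ degTerm B v w
    pointwise (yes w∈A) (yes w∈B) = trans (degTerm-∈ v w∈A) (sym (degTerm-∈ v w∈B))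
    pointwise (yes w∈A) (no  w∉B) = trans (degTerm-∈ v w∈A) (trans (A∖B w∈A w∉B) (sym (degTerm-∉ v w∉B)))
    pointwise (no  w∉A) (yes w∈B) = trans (degTerm-∉ v w∉A) (trans (sym (B∖A w∈B w∉A)) (sym (degTerm-∈ v w∈B)))
    pointwise (no  w∉A) (no  w∉B) = trans (degTerm-∉ v w∉A) (sym (degTerm-∉ v w∉B))

  Separated : Subset n → Set
  Separated A = ∀ {v w} → v ∈ A → w ∉ A → mult (suc v) (suc w) ≡ 0

  Separated-∁ : ∀ {A} → Separated A → Separated (∁ A)
  Separated-∁ sep v∈∁A w∉∁A =
    trans (symmetric _ _) (sep (x∉∁p⇒x∈p w∉∁A) (x∈∁p⇒x∉p v∈∁A))

  Separated⇒deg≡0 : ∀ {A} → Separated A → ∀ {v} → v ∉ A → deg G A v ≡ 0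
  Separated⇒deg≡0 {A} sep {v} v∉A = ∑-≡0 λ w → degTerm≡0 (w ∈? A)
    where
    degTerm≡0 : ∀ {w} → Dec (w ∈ A) → degTerm A v w ≡ 0
    degTerm≡0 (yes w∈A) = trans (degTerm-∈ v w∈A) (trans (symmetric _ _) (sep w∈A v∉A))
    degTerm≡0 (no  w∉A) = degTerm-∉ v w∉A

  Separated⇒¬Path : ∀ {A a b} → Separated A → a ∈ A → b ∉ A → ¬ Path (multMinusSink G) a b
  Separated⇒¬Path {A} sep a∈A b∉A path
    with boundaryEdge (_∈? ∁ A) path (x∈p⇒x∉∁p a∈A) (x∉p⇒x∈∁p b∉A)
  ... | x , y , x∉∁A , y∈∁A , 0<mult =
    <⇒≢ 0<mult (sym (sep (x∉∁p⇒x∈p x∉∁A) (x∈∁p⇒x∉p y∈∁A)))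

  Separated-reachable : ∀ {u} (reachable? : Decidable (Path (multMinusSink G) u)) →
                        Separated (subsetOf reachable?)
  Separated-reachable reachable? {v} {w} v∈ w∉ with mult (suc v) (suc w) ≟ 0
  ... | yes mult≡0 = mult≡0
  ... | no  mult≢0 = contradiction
    (∈-subsetOf⁺ reachable? (Path-snoc (∈-subsetOf⁻ reachable? v∈) (n≢0⇒n>0 mult≢0))) w∉

  IsPFOn-cong : ∀ {A p q} → (∀ {v} → v ∈ A → p v ≡ q v) → IsPFOn G A p → IsPFOn G A q
  IsPFOn-cong p≗q (positive , parks) =
    (λ v v∈A → subst (1 ≤_) (p≗q v∈A) (positive v v∈A)) ,
    λ S S⊆A S≢∅ → let (v , v∈S , pv≤) = parks S S⊆A S≢∅ in
      v , v∈S , subst (_≤ _) (p≗q (S⊆A v∈S)) pv≤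

  IsPF-restrict : ∀ {p A} → IsPF G p → Separated A → IsPFOn G A p
  IsPF-restrict {p} {A} (positive , parks) sep =
    (λ v _ → positive v ∈⊤) ,
    λ S S⊆A S≢∅ → let (v , v∈S , pv≤) = parks S (λ _ → ∈⊤) S≢∅ in
      v , v∈S , subst (λ d → p v ≤ degSink G v + d) (deg-cong v (⊤∖A (S⊆A v∈S)) A∖⊤) pv≤
    where
    ⊤∖A : ∀ {S v w} → v ∈ A → w ∈ ⊤ ─ S → w ∉ A ─ S → mult (suc v) (suc w) ≡ 0
    ⊤∖A {S} v∈A w∈⊤─S w∉A─S =
      sep v∈A λ w∈A → w∉A─S (x∈p∧x∉q⇒x∈p─q w∈A (x∈p─q⇒x∉q ⊤ S w∈⊤─S))
    A∖⊤ : ∀ {S v w} → w ∈ A ─ S → w ∉ ⊤ ─ S → mult (suc v) (suc w) ≡ 0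
    A∖⊤ {S} w∈A─S w∉⊤─S = contradiction (x∈p∧x∉q⇒x∈p─q ∈⊤ (x∈p─q⇒x∉q A S w∈A─S)) w∉⊤─S

  Separated⇒Decomposable : ∀ {p A} → IsPF G p → Separated A → Decomposable G p A
  Separated⇒Decomposable {p} pf sep =
    IsPF-restrict pf sep ,
    IsPFOn-cong (λ {v} v∈∁A → sym (cong (p v ∸_) (Separated⇒deg≡0 sep (x∈∁p⇒x∉p v∈∁A))))
                (IsPF-restrict pf (Separated-∁ sep))

  -- Reachability from u is decided only under ¬¬, which suffices for a negative goal.
  prime⇒¬¬Path : ∀ {p} → IsPrimePF G p → ∀ u v → ¬ ¬ Path (multMinusSink G) u v
  prime⇒¬¬Path (pf , prime) u v ¬path = ¬¬-∀-Fin (λ _ → ¬¬-excluded-middle) λ reachable? →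
    prime (subsetOf reachable?)
          (u , ∈-subsetOf⁺ reachable? here)
          (v , x∉p⇒x∈∁p λ v∈ → ¬path (∈-subsetOf⁻ reachable? v∈))
          (Separated⇒Decomposable pf (Separated-reachable reachable?))

  cutVertex⇒¬prime : IsCutVertex G → ∀ p → ¬ IsPrimePF G p
  cutVertex⇒¬prime cut p prime =
    ¬¬-∀-Fin (λ u → ¬¬-∀-Fin (prime⇒¬¬Path prime u)) cut

  -- outside ∷ S is S as a set of vertices of G; it does not contain the sink.
  one-isPF : IsPF G one
  one-isPF = (λ _ _ → ≤-refl) , λ S _ (s , s∈S) →
    entersAt (boundaryEdge (_∈? (outside ∷ S)) (connected zero (suc s)) (λ ()) (there s∈S))
    where
    entersAt : ∀ {S} → ∃₂ (λ x y → x ∉ outside ∷ S × y ∈ outside ∷ S × 0 < mult x y) →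
               ∃ λ v → v ∈ S × 1 ≤ degSink G v + deg G (⊤ ─ S) v
    entersAt (zero , suc v , _ , there v∈S , 0<mult) =
      v , v∈S , ≤-trans (subst (0 <_) (symmetric _ _) 0<mult) (m≤m+n _ _)
    entersAt (suc u , suc v , u∉S , there v∈S , 0<mult) =
      v , v∈S , ≤-trans (subst (0 <_) (symmetric _ _) 0<mult)
                        (≤-trans (mult≤deg v (x∈p∧x∉q⇒x∈p─q ∈⊤ (λ u∈S → u∉S (there u∈S))))
                                 (m≤n+m _ _))

  decomposable-one⇒Separated : ∀ {A} → Decomposable G one A → Separated (∁ A)
  decomposable-one⇒Separated (_ , positive , _) {v} {w} v∈∁A w∉∁A =
    n≤0⇒n≡0 (subst (mult (suc v) (suc w) ≤_) (1≤1∸n⇒n≡0 (positive v v∈∁A))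
                   (mult≤deg v (x∉∁p⇒x∈p w∉∁A)))

  ¬cutVertex⇒one-prime : ¬ IsCutVertex G → IsPrimePF G one
  ¬cutVertex⇒one-prime ¬cut = one-isPF , λ A (a , a∈A) (b , b∈∁A) decomposable →
    ¬cut λ connected′ → Separated⇒¬Path (decomposable-one⇒Separated decomposable)
                                       b∈∁A (x∈p⇒x∉∁p a∈A) (connected′ b a)

proposition2p3 : {n : ℕ} (G : Graph n) →
    (¬ IsCutVertex G → IsPrimePF G one) ×
    (IsCutVertex G → (p : Fin n → ℕ) → ¬ IsPrimePF G p)
proposition2p3 G = ¬cutVertex⇒one-prime G , cutVertex⇒¬prime G
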